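{- For $k\geq 0$ let $\varphi_k(y)=\sum_{n\geq k+1}op_{n,k}^{k+1}y^n$, where $op_{n,k}^{k+1}$ is the number of ordered preference sets of length $n$ with exactly $k$ flaws and leading term $k+1$. Then $\varphi_0(y)=y[C(y)]^2$ and $\varphi_{k+1}(y)=yC(y)\varphi_k(y)$ for all $k\geq 0$, where $C(y)=\frac{1-\sqrt{1-4y}}{2y}=\sum_{n\geq0}\frac{1}{n+1}\binom{2n}{n}y^n$.
   Context: Parking model: $n$ parking spaces numbered $1,\dots,n$ from left to right; a preference set of length $n$ is a sequence $(a_1,\dots,a_n)$ with $a_i\in[n]$. Cars arrive in order; car $i$ goes to space $a_i$, and if it is occupied, moves to the first unoccupied space to the right; if there is none, the car cannot park. The number of flaws is the number of cars that cannot park. A preference set is ordered if $a_1\leq\cdots\leq a_n$; its leading term is $a_1$. Identities are of formal power series in $y$. -}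

module Defs where

open import Data.Bool using (Bool; true; false; _∧_; not; if_then_else_)
open import Data.Nat using (ℕ; zero; suc; _+_; _*_; _∸_; _/_; _≤ᵇ_; _≡ᵇ_)
open import Data.Nat.Combinatorics using (_C_)
open import Data.List using (List; []; _∷_; map; concatMap; upTo; length; filterᵇ)
open import Data.Nat.ListAction using (sum)
open import Data.Bool.ListAction using (any)
open import Data.Maybe using (Maybe; just; nothing)

-- Formal power series over ℕ, represented by coefficient sequences.
Series : Set
Series = ℕ → ℕ

_⊛_ : Series → Series → Series
(f ⊛ g) n = sum (map (λ i → f i * g (n ∸ i)) (upTo (suc n)))

yTimes : Series → Series
yTimes f zero = 0
yTimes f (suc n) = f n

-- C(y) = Σ_{n≥0} (1/(n+1)) binom(2n,n) y^n  (Catalan numbers; division is exact)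
Cat : Series
Cat n = ((2 * n) C n) / suc n

range1 : ℕ → List ℕ
range1 m = map suc (upTo m)

seqs : ℕ → ℕ → List (List ℕ)
seqs zero m = [] ∷ []
seqs (suc l) m = concatMap (λ a → map (a ∷_) (seqs l m)) (range1 m)

occupied : ℕ → List ℕ → Bool
occupied s occ = any (λ o → o ≡ᵇ s) occ

firstFreeFrom : ℕ → List ℕ → List ℕ → Maybe ℕ
firstFreeFrom a occ [] = nothing
firstFreeFrom a occ (s ∷ ss) =
  if (a ≤ᵇ s) ∧ not (occupied s occ) then just s else firstFreeFrom a occ ss

-- number of flaws: cars (arriving in order) that cannot park, n spaces
flawsAux : ℕ → List ℕ → List ℕ → ℕ
flawsAux n occ [] = 0
flawsAux n occ (a ∷ as) with firstFreeFrom a occ (range1 n)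
... | nothing = suc (flawsAux n occ as)
... | just s = flawsAux n (s ∷ occ) as

flaws : ℕ → List ℕ → ℕ
flaws n prefs = flawsAux n [] prefs

orderedᵇ : List ℕ → Bool
orderedᵇ [] = true
orderedᵇ (a ∷ []) = true
orderedᵇ (a ∷ b ∷ as) = (a ≤ᵇ b) ∧ orderedᵇ (b ∷ as)

leadingIsᵇ : ℕ → List ℕ → Bool
leadingIsᵇ t [] = false
leadingIsᵇ t (a ∷ _) = a ≡ᵇ t

op : ℕ → ℕ → ℕ → ℕ
op n k t = length (filterᵇ (λ p → orderedᵇ p ∧ ((flaws n p ≡ᵇ k) ∧ leadingIsᵇ t p)) (seqs n n))

φ : ℕ → Series
φ k n = if suc k ≤ᵇ n then op n k (suc k) else 0

-- An ordered preference set with leading term k + 1 never uses spaces 1, …, k, so it has exactly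
-- k flaws iff it fills spaces k + 1, …, n. For weakly increasing preferences the process only
-- depends on the rightmost occupied space, and reading each car as an up-step and each advance of
-- the least admissible preference as a down-step turns the filling sequences of length n = k + 1 + m
-- into lattice walks, counted by the ballot number [yᵐ] C(y)^(k+2). Hence φ_k = y^(k+1) C^(k+2).
-- The factorisation C^(j+2) = C · C^(j+1) follows from decomposing walks by their last step, and
-- the reflection principle gives (m + 1) · [yᵐ] C = C(2m, m), the Catalan formula.
module Submission where

open import Defs
open import Data.Bool using (Bool; true; false; if_then_else_; _∧_; _∨_; not; T)
open import Data.Bool.Properties using (T-≡; T-∧; ∧-zeroʳ; ∧-identityʳ; ∨-zeroʳ; ∨-identityʳ)
open import Data.Empty using (⊥-elim)
open import Data.List using (List; []; _∷_; map; length; filterᵇ; upTo; applyUpTo; _++_; concatMap)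
open import Data.List.Properties using (length-++; filter-++; map-++; map-∘; map-applyUpTo; upTo-∷ʳ)
open import Data.Maybe using (just; nothing)
open import Data.Nat
open import Data.Nat.Properties
open import Data.Nat.DivMod using (m*n/n≡m)
open import Data.Nat.Combinatorics using (_C_; nC1≡n; nCk≡nC[n∸k]; nCk+nC[k+1]≡[n+1]C[k+1]; k>n⇒nCk≡0)
open import Data.Nat.Tactic.RingSolver using (solve-∀)
open import Data.Nat.ListAction using (sum)
open import Data.Nat.ListAction.Properties using (sum-++)
open import Data.Product using (_×_; _,_; map₁)
open import Data.Sum using (_⊎_; inj₁; inj₂; [_,_])
open import Function using (_∘_; id; Equivalence)
open import Relation.Binary.PropositionalEquality using (_≡_; _≢_; refl; sym; trans; cong; cong₂; subst; subst₂; _≗_; module ≡-Reasoning)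
open import Relation.Nullary using (yes; no)
open import Relation.Nullary.Decidable using (T?)
open import Relation.Binary.Definitions using (tri<; tri≈; tri>)
open import Algebra.Properties.CommutativeSemigroup +-commutativeSemigroup using (interchange; x∙yz≈y∙xz; xy∙z≈xz∙y)
open ≡-Reasoning

≤ᵇ-true : ∀ {m n} → m ≤ n → (m ≤ᵇ n) ≡ true
≤ᵇ-true p = Equivalence.to T-≡ (≤⇒≤ᵇ p)

≤ᵇ-true⇒≤ : ∀ {m n} → (m ≤ᵇ n) ≡ true → m ≤ n
≤ᵇ-true⇒≤ {m} {n} e = ≤ᵇ⇒≤ m n (Equivalence.from T-≡ e)

≤ᵇ-false : ∀ {m n} → n < m → (m ≤ᵇ n) ≡ false
≤ᵇ-false {m} {n} n<m with m ≤ᵇ n in e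
... | true = ⊥-elim (<⇒≱ n<m (≤ᵇ-true⇒≤ e))
... | false = refl

≤ᵇ-false⇒> : ∀ {m n} → (m ≤ᵇ n) ≡ false → n < m
≤ᵇ-false⇒> e = ≰⇒> (λ m≤n → subst T e (≤⇒≤ᵇ m≤n))

<ᵇ-true : ∀ {m n} → m < n → (m <ᵇ n) ≡ true
<ᵇ-true = ≤ᵇ-true

<ᵇ-false : ∀ {m n} → n ≤ m → (m <ᵇ n) ≡ false
<ᵇ-false n≤m = ≤ᵇ-false (s≤s n≤m)

<ᵇ-suc : ∀ q n → (q <ᵇ suc n) ≡ (q ≤ᵇ n)
<ᵇ-suc zero n = refl
<ᵇ-suc (suc q) n = refl

≡ᵇ-true : ∀ {m n} → m ≡ n → (m ≡ᵇ n) ≡ true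
≡ᵇ-true {m} {n} e = Equivalence.to T-≡ (≡⇒≡ᵇ m n e)

≡ᵇ-true⇒≡ : ∀ {m n} → (m ≡ᵇ n) ≡ true → m ≡ n
≡ᵇ-true⇒≡ {m} {n} e = ≡ᵇ⇒≡ m n (Equivalence.from T-≡ e)

≡ᵇ-false : ∀ {m n} → m ≢ n → (m ≡ᵇ n) ≡ false
≡ᵇ-false {m} {n} m≢n with m ≡ᵇ n in e
... | true = ⊥-elim (m≢n (≡ᵇ-true⇒≡ e))
... | false = refl

≡ᵇ-+ˡ : ∀ m x y → (m + x ≡ᵇ m + y) ≡ (x ≡ᵇ y)
≡ᵇ-+ˡ zero x y = refl
≡ᵇ-+ˡ (suc m) x y = ≡ᵇ-+ˡ m x y

∑ : ℕ → (ℕ → ℕ) → ℕ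
∑ zero f = 0
∑ (suc n) f = ∑ n f + f n

∑-cong : ∀ n {f g : ℕ → ℕ} → (∀ i → i < n → f i ≡ g i) → ∑ n f ≡ ∑ n g
∑-cong zero f≡g = refl
∑-cong (suc n) f≡g = cong₂ _+_ (∑-cong n (λ i i<n → f≡g i (m<n⇒m<1+n i<n))) (f≡g n ≤-refl)

∑-zero : ∀ n → ∑ n (λ _ → 0) ≡ 0
∑-zero zero = refl
∑-zero (suc n) = trans (+-identityʳ _) (∑-zero n)

∑-distrib-+ : ∀ n (f g : ℕ → ℕ) → ∑ n (λ i → f i + g i) ≡ ∑ n f + ∑ n g
∑-distrib-+ zero f g = refl
∑-distrib-+ (suc n) f g = trans (cong (_+ (f n + g n)) (∑-distrib-+ n f g)) (interchange (∑ n f) (∑ n g) (f n) (g n))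

∑-upTo : ∀ n (f : ℕ → ℕ) → sum (map f (upTo n)) ≡ ∑ n f
∑-upTo zero f = refl
∑-upTo (suc n) f = begin
  sum (map f (upTo (suc n)))       ≡⟨ cong (sum ∘ map f) (sym (upTo-∷ʳ n)) ⟩
  sum (map f (upTo n ++ n ∷ []))   ≡⟨ cong sum (map-++ f (upTo n) (n ∷ [])) ⟩
  sum (map f (upTo n) ++ f n ∷ []) ≡⟨ sum-++ (map f (upTo n)) (f n ∷ []) ⟩
  sum (map f (upTo n)) + (f n + 0) ≡⟨ cong₂ _+_ (∑-upTo n f) (+-identityʳ (f n)) ⟩
  ∑ n f + f n                      ∎

∑-indicator : ∀ n c x → ∑ n (λ i → if i ≡ᵇ c then x else 0) ≡ (if c <ᵇ n then x else 0)
∑-indicator zero c x = refl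
∑-indicator (suc n) c x with <-cmp c n
... | tri< c<n _ _ rewrite ∑-indicator n c x | <ᵇ-true c<n | <ᵇ-true (m<n⇒m<1+n c<n)
        | ≡ᵇ-false {n} {c} (>⇒≢ c<n) = +-identityʳ x
... | tri≈ _ refl _ rewrite ∑-indicator n n x | <ᵇ-false (≤-refl {n}) | <ᵇ-true (n<1+n n)
        | ≡ᵇ-true (refl {x = n}) = refl
... | tri> _ _ c>n rewrite ∑-indicator n c x | <ᵇ-false (<⇒≤ c>n) | <ᵇ-false {c} {suc n} c>n
        | ≡ᵇ-false {n} {c} (<⇒≢ c>n) = refl

∑-split-≤ᵇ : ∀ n w (f : ℕ → ℕ) →
  ∑ n (λ i → if w ≤ᵇ i then f i else 0) ≡ (if w <ᵇ n then f w else 0) + ∑ n (λ i → if suc w ≤ᵇ i then f i else 0)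
∑-split-≤ᵇ zero w f = refl
∑-split-≤ᵇ (suc n) w f with <-cmp w n
... | tri< w<n _ _ rewrite ∑-split-≤ᵇ n w f | <ᵇ-true w<n | <ᵇ-true (m<n⇒m<1+n w<n) | ≤ᵇ-true (<⇒≤ w<n)
  = +-assoc (f w) _ (f n)
... | tri≈ _ refl _ rewrite ∑-split-≤ᵇ n n f | <ᵇ-false (≤-refl {n}) | <ᵇ-true (n<1+n n) | ≤ᵇ-true (≤-refl {n})
  = trans (+-comm _ (f n)) (cong (f n +_) (sym (+-identityʳ _)))
... | tri> _ _ w>n rewrite ∑-split-≤ᵇ n w f | <ᵇ-false (<⇒≤ w>n) | <ᵇ-false {w} {suc n} w>n | ≤ᵇ-false w>n
  = refl

-- Lattice walks and ballot numbers

-- walks e h u d counts the orderings of u up-steps and d down-steps whose walk from height h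
-- never goes below 0 and ends at height ≥ e; the clauses branch on the first step.
walks : ℕ → ℕ → ℕ → ℕ → ℕ
walks e h zero d = if e + d ≤ᵇ h then 1 else 0
walks e zero (suc u) d = walks e 1 u d
walks e (suc h) (suc u) zero = walks e (suc (suc h)) u zero
walks e (suc h) (suc u) (suc d) = walks e (suc (suc h)) u (suc d) + walks e h (suc u) d

walks-no-downs : ∀ h u → walks 0 h u 0 ≡ 1
walks-no-downs h zero = refl
walks-no-downs zero (suc u) = walks-no-downs 1 u
walks-no-downs (suc h) (suc u) = walks-no-downs (suc (suc h)) u

walks-too-many-downs : ∀ h u d → h + u < d → walks 0 h u d ≡ 0
walks-too-many-downs h zero d h+0<d rewrite ≤ᵇ-false {d} {h} (subst (_< d) (+-identityʳ h) h+0<d) = refl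
walks-too-many-downs zero (suc u) d u<d = walks-too-many-downs 1 u d u<d
walks-too-many-downs (suc h) (suc u) (suc d) (s≤s h+u<d) =
  cong₂ _+_ (walks-too-many-downs (suc (suc h)) u (suc d) (s≤s (subst (_< d) (+-suc h u) h+u<d)))
            (walks-too-many-downs h (suc u) d h+u<d)

walks-positive-end : ∀ h u d → d < h + u → walks 1 h u d ≡ walks 0 h u d
walks-positive-end h zero d d<h+0 with subst (d <_) (+-identityʳ h) d<h+0
... | d<h rewrite ≤ᵇ-true d<h | ≤ᵇ-true (<⇒≤ d<h) = refl
walks-positive-end zero (suc u) d d<u = walks-positive-end 1 u d d<u
walks-positive-end (suc h) (suc u) zero _ = walks-positive-end (suc (suc h)) u zero (s≤s z≤n)
walks-positive-end (suc h) (suc u) (suc d) (s≤s d<h+u) =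
  cong₂ _+_ (walks-positive-end (suc (suc h)) u (suc d) (s≤s (subst (d <_) (+-suc h u) d<h+u)))
            (walks-positive-end h (suc u) d d<h+u)

-- Decomposition by the last step: a final down-step needs the walk before it to end at height ≥ 1.
walks-last-step : ∀ h u d → walks 0 h (suc u) (suc d) ≡ walks 0 h u (suc d) + walks 1 h (suc u) d
walks-last-step zero zero d = refl
walks-last-step zero (suc u) d = walks-last-step 1 u d
walks-last-step (suc h) zero zero = cong suc (walks-no-downs h 1)
walks-last-step (suc h) zero (suc d) rewrite walks-last-step h 0 d =
  x∙yz≈y∙xz (walks 0 (2 + h) 0 (2 + d)) (walks 0 h 0 (suc d)) (walks 1 h 1 d)
walks-last-step (suc h) (suc u) zero
  rewrite walks-last-step (2 + h) u 0 | walks-no-downs h (2 + u) | walks-no-downs h (suc u)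
  = xy∙z≈xz∙y (walks 0 (2 + h) u 1) (walks 1 (2 + h) (suc u) 0) 1
walks-last-step (suc h) (suc u) (suc d) =
  trans (cong₂ _+_ (walks-last-step (2 + h) u (suc d)) (walks-last-step h (suc u) d))
        (interchange (walks 0 (2 + h) u (2 + d)) (walks 1 (2 + h) (suc u) (suc d)) (walks 0 h (suc u) (suc d)) _)

-- ballot j m = [yᵐ] C(y)^(j+1): walks from 0 that end at height j.
ballot : ℕ → ℕ → ℕ
ballot j m = walks 0 0 (j + m) m

ballot-zero : ∀ j {m} → m ≡ 0 → ballot j m ≡ 1
ballot-zero j refl = walks-no-downs 0 (j + 0)

ballot-0-suc : ∀ m → ballot 0 (suc m) ≡ ballot 1 m
ballot-0-suc m = begin
  walks 0 0 (suc m) (suc m)                         ≡⟨ walks-last-step 0 m m ⟩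
  walks 0 0 m (suc m) + walks 1 0 (suc m) m         ≡⟨ cong₂ _+_ (walks-too-many-downs 0 m (suc m) ≤-refl)
                                                                 (walks-positive-end 0 (suc m) m ≤-refl) ⟩
  walks 0 0 (suc m) m                               ∎

ballot-suc-suc : ∀ j m → ballot (suc j) (suc m) ≡ ballot (suc (suc j)) m + ballot j (suc m)
ballot-suc-suc j m = begin
  walks 0 0 (suc j + suc m) (suc m)                               ≡⟨ cong (λ u → walks 0 0 (suc u) (suc m)) (+-suc j m) ⟩
  walks 0 0 (2 + (j + m)) (suc m)                                 ≡⟨ walks-last-step 0 (suc (j + m)) m ⟩
  walks 0 0 (suc (j + m)) (suc m) + walks 1 0 (2 + (j + m)) m
    ≡⟨ cong₂ _+_ (cong (λ u → walks 0 0 u (suc m)) (sym (+-suc j m)))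
                 (walks-positive-end 0 (2 + (j + m)) m (s≤s (m≤n+m m (suc j)))) ⟩
  walks 0 0 (j + suc m) (suc m) + walks 0 0 (2 + (j + m)) m       ≡⟨ +-comm (walks 0 0 (j + suc m) (suc m)) _ ⟩
  walks 0 0 (2 + (j + m)) m + walks 0 0 (j + suc m) (suc m)       ∎

∑-suc-∸ : ∀ m (f : ℕ → ℕ → ℕ) → ∑ (suc m) (λ i → f i (suc m ∸ i)) ≡ ∑ (suc m) (λ i → f i (suc (m ∸ i)))
∑-suc-∸ m f = ∑-cong (suc m) (λ i i<1+m → cong (f i) (+-∸-assoc 1 (≤-pred i<1+m)))

ballot-convolution : ∀ m j → ballot (suc j) m ≡ ∑ (suc m) (λ i → ballot 0 i * ballot j (m ∸ i))
ballot-convolution zero j =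
  trans (ballot-zero (suc j) refl) (sym (cong₂ (λ x y → 0 + x * y) (ballot-zero 0 refl) (ballot-zero j refl)))
ballot-convolution (suc m) zero = begin
  ballot 1 (suc m)                                                       ≡⟨ ballot-suc-suc 0 m ⟩
  ballot 2 m + ballot 0 (suc m)                                          ≡⟨ cong₂ _+_ (ballot-convolution m 1) (sym (*-identityʳ _)) ⟩
  ∑ (suc m) (λ i → ballot 0 i * ballot 1 (m ∸ i)) + ballot 0 (suc m) * 1
    ≡⟨ cong₂ _+_ (∑-cong (suc m) (λ i _ → cong (ballot 0 i *_) (ballot-0-suc (m ∸ i))))
                 (cong (ballot 0 (suc m) *_) (ballot-zero 0 (n∸n≡0 m))) ⟨
  ∑ (suc m) (λ i → ballot 0 i * ballot 0 (suc (m ∸ i))) + ballot 0 (suc m) * ballot 0 (m ∸ m)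
    ≡⟨ cong (_+ ballot 0 (suc m) * ballot 0 (m ∸ m)) (∑-suc-∸ m (λ i t → ballot 0 i * ballot 0 t)) ⟨
  ∑ (suc (suc m)) (λ i → ballot 0 i * ballot 0 (suc m ∸ i))             ∎
ballot-convolution (suc m) (suc j) = begin
  ballot (2 + j) (suc m)                                                 ≡⟨ ballot-suc-suc (suc j) m ⟩
  ballot (3 + j) m + ballot (suc j) (suc m)                              ≡⟨ cong₂ _+_ (ballot-convolution m (2 + j)) (ballot-convolution (suc m) j) ⟩
  S₁ + (S₂ + ballot 0 (suc m) * ballot j (m ∸ m))                        ≡⟨ +-assoc S₁ S₂ _ ⟨
  (S₁ + S₂) + ballot 0 (suc m) * ballot j (m ∸ m)
    ≡⟨ cong₂ _+_ merge (cong (ballot 0 (suc m) *_) (trans (ballot-zero j (n∸n≡0 m)) (sym (ballot-zero (suc j) (n∸n≡0 m))))) ⟩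
  ∑ (suc m) (λ i → ballot 0 i * ballot (suc j) (suc m ∸ i)) + ballot 0 (suc m) * ballot (suc j) (m ∸ m) ∎
  where
    S₁ = ∑ (suc m) (λ i → ballot 0 i * ballot (2 + j) (m ∸ i))
    S₂ = ∑ (suc m) (λ i → ballot 0 i * ballot j (suc m ∸ i))
    merge : S₁ + S₂ ≡ ∑ (suc m) (λ i → ballot 0 i * ballot (suc j) (suc m ∸ i))
    merge = begin
      S₁ + S₂                                                            ≡⟨ cong (S₁ +_) (∑-suc-∸ m (λ i t → ballot 0 i * ballot j t)) ⟩
      S₁ + ∑ (suc m) (λ i → ballot 0 i * ballot j (suc (m ∸ i)))         ≡⟨ ∑-distrib-+ (suc m) _ _ ⟨
      ∑ (suc m) (λ i → ballot 0 i * ballot (2 + j) (m ∸ i) + ballot 0 i * ballot j (suc (m ∸ i)))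
        ≡⟨ ∑-cong (suc m) (λ i _ → trans (sym (*-distribˡ-+ (ballot 0 i) _ _))
                                         (cong (ballot 0 i *_) (sym (ballot-suc-suc j (m ∸ i))))) ⟩
      ∑ (suc m) (λ i → ballot 0 i * ballot (suc j) (suc (m ∸ i)))        ≡⟨ ∑-suc-∸ m (λ i t → ballot 0 i * ballot (suc j) t) ⟨
      ∑ (suc m) (λ i → ballot 0 i * ballot (suc j) (suc m ∸ i))          ∎

-- Catalan numbers

nC[1+k]*[1+k]≡nCk*[n∸k] : ∀ n k → (n C suc k) * suc k ≡ (n C k) * (n ∸ k)
nC[1+k]*[1+k]≡nCk*[n∸k] zero zero = refl
nC[1+k]*[1+k]≡nCk*[n∸k] zero (suc k) = refl
nC[1+k]*[1+k]≡nCk*[n∸k] (suc n) zero = trans (*-identityʳ (suc n C 1)) (trans (nC1≡n (suc n)) (sym (*-identityˡ (suc n))))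
nC[1+k]*[1+k]≡nCk*[n∸k] (suc n) (suc k) = begin
  (suc n C (2 + k)) * (2 + k)                        ≡⟨ cong (_* (2 + k)) (nCk+nC[k+1]≡[n+1]C[k+1] n (suc k)) ⟨
  (X + n C (2 + k)) * (2 + k)                        ≡⟨ *-distribʳ-+ (2 + k) X (n C (2 + k)) ⟩
  X * (2 + k) + (n C (2 + k)) * (2 + k)              ≡⟨ cong₂ _+_ (*-suc X (suc k)) (nC[1+k]*[1+k]≡nCk*[n∸k] n (suc k)) ⟩
  (X + X * suc k) + X * (n ∸ suc k)                  ≡⟨ cong (_+ X * (n ∸ suc k)) (+-comm X (X * suc k)) ⟩
  (X * suc k + X) + X * (n ∸ suc k)                  ≡⟨ +-assoc (X * suc k) X _ ⟩
  X * suc k + (X + X * (n ∸ suc k))                  ≡⟨ cong₂ _+_ (nC[1+k]*[1+k]≡nCk*[n∸k] n k) absorb ⟩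
  (n C k) * (n ∸ k) + X * (n ∸ k)                    ≡⟨ *-distribʳ-+ (n ∸ k) (n C k) X ⟨
  (n C k + X) * (n ∸ k)                              ≡⟨ cong (_* (n ∸ k)) (nCk+nC[k+1]≡[n+1]C[k+1] n k) ⟩
  (suc n C suc k) * (n ∸ k)                          ∎
  where
    X = n C suc k
    absorb : X + X * (n ∸ suc k) ≡ X * (n ∸ k)
    absorb with k <? n
    ... | yes k<n rewrite +-∸-assoc 1 k<n = sym (*-suc X (n ∸ suc k))
    ... | no k≮n rewrite k>n⇒nCk≡0 {n} {suc k} (s≤s (≮⇒≥ k≮n)) = refl

ballot-one : ∀ j → ballot j 1 ≡ suc j
ballot-one zero = refl
ballot-one (suc j) = trans (ballot-suc-suc j 0) (cong₂ _+_ (ballot-zero (2 + j) refl) (ballot-one j))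

-- The reflection principle ballot j (m+1) = C(N, m+1) - C(N, m), where N = 2m + j + 2 is the
-- length of the walks, stated without subtraction.
ballot-reflection : ∀ j m {N} → N ≡ 2 + (j + (m + m)) → ballot j (suc m) + N C m ≡ N C suc m
ballot-reflection j zero refl rewrite ballot-one j | nC1≡n (2 + (j + 0)) | +-identityʳ j = +-comm (suc j) 1
ballot-reflection zero (suc m) eq =
  subst (λ N′ → ballot 0 (2 + m) + N′ C suc m ≡ N′ C (2 + m)) (sym (trans eq (index-shape m))) (begin
  ballot 0 (2 + m) + suc N C suc m                   ≡⟨ cong₂ _+_ (ballot-0-suc (suc m)) (sym (nCk+nC[k+1]≡[n+1]C[k+1] N m)) ⟩
  ballot 1 (suc m) + (N C m + N C suc m)             ≡⟨ +-assoc (ballot 1 (suc m)) (N C m) _ ⟨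
  (ballot 1 (suc m) + N C m) + N C suc m             ≡⟨ cong (_+ N C suc m) (ballot-reflection 1 m refl) ⟩
  N C suc m + N C suc m                              ≡⟨ cong (N C suc m +_) middle-symmetry ⟩
  N C suc m + N C (2 + m)                            ≡⟨ nCk+nC[k+1]≡[n+1]C[k+1] N (suc m) ⟩
  suc N C (2 + m)                                    ∎)
  where
    N = 2 + (1 + (m + m))
    index-shape : ∀ m → 2 + (0 + (suc m + suc m)) ≡ suc (2 + (1 + (m + m)))
    index-shape = solve-∀
    N≡[1+m]+[2+m] : ∀ m → 2 + (1 + (m + m)) ≡ suc m + (2 + m)
    N≡[1+m]+[2+m] = solve-∀
    middle-symmetry : N C suc m ≡ N C (2 + m)
    middle-symmetry = begin
      N C suc m                        ≡⟨ nCk≡nC[n∸k] (≤-trans (m≤m+n (suc m) (2 + m)) (≤-reflexive (sym (N≡[1+m]+[2+m] m)))) ⟩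
      N C (N ∸ suc m)                  ≡⟨ cong (λ x → N C (x ∸ suc m)) (N≡[1+m]+[2+m] m) ⟩
      N C (suc m + (2 + m) ∸ suc m)    ≡⟨ cong (N C_) (m+n∸m≡n (suc m) (2 + m)) ⟩
      N C (2 + m)                      ∎
ballot-reflection (suc j) (suc m) eq =
  subst (λ N′ → ballot (suc j) (2 + m) + N′ C suc m ≡ N′ C (2 + m)) (sym (trans eq (index-shape j m))) (begin
  ballot (suc j) (2 + m) + suc N C suc m
    ≡⟨ cong₂ _+_ (ballot-suc-suc j (suc m)) (sym (nCk+nC[k+1]≡[n+1]C[k+1] N m)) ⟩
  (ballot (2 + j) (suc m) + ballot j (2 + m)) + (N C m + N C suc m)
    ≡⟨ interchange (ballot (2 + j) (suc m)) (ballot j (2 + m)) (N C m) (N C suc m) ⟩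
  (ballot (2 + j) (suc m) + N C m) + (ballot j (2 + m) + N C suc m)
    ≡⟨ cong₂ _+_ (ballot-reflection (2 + j) m refl) (ballot-reflection j (suc m) (N-shape j m)) ⟩
  N C suc m + N C (2 + m)                            ≡⟨ nCk+nC[k+1]≡[n+1]C[k+1] N (suc m) ⟩
  suc N C (2 + m)                                    ∎)
  where
    N = 2 + (2 + j + (m + m))
    index-shape : ∀ j m → 2 + (suc j + (suc m + suc m)) ≡ suc (2 + (2 + j + (m + m)))
    index-shape = solve-∀
    N-shape : ∀ j m → 2 + (2 + j + (m + m)) ≡ 2 + (j + (suc m + suc m))
    N-shape = solve-∀

ballot-0*[1+m]≡2mCm : ∀ m → ballot 0 m * suc m ≡ (2 * m) C m
ballot-0*[1+m]≡2mCm zero = refl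
ballot-0*[1+m]≡2mCm (suc m) = trans (+-cancelʳ-≡ ((N C suc m) * suc m) _ _ (begin
  b * (2 + m) + (N C suc m) * suc m      ≡⟨ cong (b * (2 + m) +_) (nC[1+k]*[1+k]≡nCk*[n∸k] N m) ⟩
  b * (2 + m) + (N C m) * (N ∸ m)        ≡⟨ cong (λ x → b * (2 + m) + (N C m) * x) N∸m≡2+m ⟩
  b * (2 + m) + (N C m) * (2 + m)        ≡⟨ *-distribʳ-+ (2 + m) b (N C m) ⟨
  (b + N C m) * (2 + m)                  ≡⟨ cong (_* (2 + m)) (ballot-reflection 0 m refl) ⟩
  (N C suc m) * (2 + m)                  ≡⟨ *-suc (N C suc m) (suc m) ⟩
  N C suc m + (N C suc m) * suc m        ∎)) (cong (_C suc m) (sym (two-m m)))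
  where
    N = 2 + (0 + (m + m))
    b = ballot 0 (suc m)
    two-m : ∀ m → 2 * suc m ≡ 2 + (0 + (m + m))
    two-m = solve-∀
    N≡m+[2+m] : ∀ m → 2 + (0 + (m + m)) ≡ m + (2 + m)
    N≡m+[2+m] = solve-∀
    N∸m≡2+m : N ∸ m ≡ 2 + m
    N∸m≡2+m = trans (cong (_∸ m) (N≡m+[2+m] m)) (m+n∸m≡n m (2 + m))

Cat≡ballot-0 : ∀ m → Cat m ≡ ballot 0 m
Cat≡ballot-0 m = trans (cong (_/ suc m) (sym (ballot-0*[1+m]≡2mCm m))) (m*n/n≡m (ballot 0 m) (suc m))

count : (List ℕ → Bool) → ℕ → ℕ → ℕ
count P zero m = if P [] then 1 else 0
count P (suc l) m = ∑ m (λ i → count (λ s → P (suc i ∷ s)) l m)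

length-filter-∷ : ∀ (P : List ℕ → Bool) a ys →
  length (filterᵇ P (map (a ∷_) ys)) ≡ length (filterᵇ (λ s → P (a ∷ s)) ys)
length-filter-∷ P a [] = refl
length-filter-∷ P a (y ∷ ys) with P (a ∷ y)
... | true = cong suc (length-filter-∷ P a ys)
... | false = length-filter-∷ P a ys

length-filter-seqs : ∀ (P : List ℕ → Bool) l m → length (filterᵇ P (seqs l m)) ≡ count P l m
length-filter-seqs P zero m with P []
... | true = refl
... | false = refl
length-filter-seqs P (suc l) m = begin
  length (filterᵇ P (concatMap extend (map suc (upTo m))))  ≡⟨ by-first (map suc (upTo m)) ⟩
  sum (map countFrom (map suc (upTo m)))                    ≡⟨ cong sum (map-∘ (upTo m)) ⟨
  sum (map (countFrom ∘ suc) (upTo m))                      ≡⟨ ∑-upTo m (countFrom ∘ suc) ⟩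
  count P (suc l) m                                         ∎
  where
    extend : ℕ → List (List ℕ)
    extend a = map (a ∷_) (seqs l m)
    countFrom : ℕ → ℕ
    countFrom a = count (λ s → P (a ∷ s)) l m
    by-first : ∀ as → length (filterᵇ P (concatMap extend as)) ≡ sum (map countFrom as)
    by-first [] = refl
    by-first (a ∷ as) = begin
      length (filterᵇ P (extend a ++ concatMap extend as))
        ≡⟨ cong length (filter-++ (T? ∘ P) (extend a) (concatMap extend as)) ⟩
      length (filterᵇ P (extend a) ++ filterᵇ P (concatMap extend as))
        ≡⟨ length-++ (filterᵇ P (extend a)) ⟩
      length (filterᵇ P (extend a)) + length (filterᵇ P (concatMap extend as))
        ≡⟨ cong₂ _+_ (trans (length-filter-∷ P a (seqs l m)) (length-filter-seqs (λ s → P (a ∷ s)) l m)) (by-first as) ⟩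
      countFrom a + sum (map countFrom as)                                   ∎

count-cong : ∀ {P Q : List ℕ → Bool} l m → (∀ s → length s ≡ l → P s ≡ Q s) → count P l m ≡ count Q l m
count-cong zero m P≡Q = cong (λ b → if b then 1 else 0) (P≡Q [] refl)
count-cong (suc l) m P≡Q = ∑-cong m (λ i _ → count-cong l m (λ s len → P≡Q (suc i ∷ s) (cong suc len)))

count-none : ∀ {P : List ℕ → Bool} l m → (∀ s → length s ≡ l → P s ≡ false) → count P l m ≡ 0
count-none zero m ¬P rewrite ¬P [] refl = refl
count-none (suc l) m ¬P = trans (∑-cong m (λ i _ → count-none l m (λ s len → ¬P (suc i ∷ s) (cong suc len)))) (∑-zero m)

-- Parking with weakly increasing preferences

-- For weakly increasing arrivals only the rightmost occupied space L matters: the next car parks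
-- at a ⊔ suc L if that space exists. On a flaw L is bumped; for a ≤ n a flaw means L ≥ n, so this
-- changes no later outcome, but it makes (n ∸ L) + frontierFlaws n L (a ∷ s) the same for all
-- a ≤ suc L (frontierFlaws-≤suc).
frontierFlaws : ℕ → ℕ → List ℕ → ℕ
frontierFlaws n L [] = 0
frontierFlaws n L (a ∷ s) = if a ⊔ suc L ≤ᵇ n then frontierFlaws n (a ⊔ suc L) s else suc (frontierFlaws n (suc L) s)

frontierFlaws-park : ∀ n L a s → (a ⊔ suc L ≤ᵇ n) ≡ true → frontierFlaws n L (a ∷ s) ≡ frontierFlaws n (a ⊔ suc L) s
frontierFlaws-park n L a s fits rewrite fits = refl

frontierFlaws-flaw : ∀ n L a s → (a ⊔ suc L ≤ᵇ n) ≡ false → frontierFlaws n L (a ∷ s) ≡ suc (frontierFlaws n (suc L) s)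
frontierFlaws-flaw n L a s full rewrite full = refl

record FilledUpTo (n : ℕ) (occ : List ℕ) (prev L : ℕ) : Set where
  constructor filledUpTo
  field occupied⇔≤ : ∀ x → prev ≤ x → 1 ≤ x → x ≤ n → occupied x occ ≡ (x ≤ᵇ L)
open FilledUpTo

interval : ℕ → ℕ → List ℕ
interval b zero = []
interval b (suc c) = b ∷ interval (suc b) c

applyUpTo≡interval : ∀ (f : ℕ → ℕ) b c → (∀ i → f i ≡ b + i) → applyUpTo f c ≡ interval b c
applyUpTo≡interval f b zero _ = refl
applyUpTo≡interval f b (suc c) f≡b+ =
  cong₂ _∷_ (trans (f≡b+ 0) (+-identityʳ b)) (applyUpTo≡interval (f ∘ suc) (suc b) c (λ i → trans (f≡b+ (suc i)) (+-suc b i)))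

range1≡interval : ∀ n → range1 n ≡ interval 1 n
range1≡interval n = trans (map-applyUpTo id suc n) (applyUpTo≡interval suc 1 n (λ _ → refl))

firstFreeFrom-interval : ∀ a occ q b c →
  (∀ x → b ≤ x → x < b + c → ((a ≤ᵇ x) ∧ not (occupied x occ)) ≡ (q ≤ᵇ x)) → b ≤ q →
  firstFreeFrom a occ (interval b c) ≡ (if q <ᵇ b + c then just q else nothing)
firstFreeFrom-interval a occ q b zero _ b≤q rewrite +-identityʳ b | <ᵇ-false b≤q = refl
firstFreeFrom-interval a occ q b (suc c) free≡q≤ b≤q rewrite free≡q≤ b ≤-refl (m<m+n b z<s) with m≤n⇒m<n∨m≡n b≤q
... | inj₂ refl rewrite ≤ᵇ-true (≤-refl {b}) | <ᵇ-true (m<m+n b (z<s {c})) = refl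
... | inj₁ b<q rewrite ≤ᵇ-false b<q | +-suc b c =
  firstFreeFrom-interval a occ q (suc b) c (λ x b<x x<e → free≡q≤ x (<⇒≤ b<x) x<e) b<q

firstFreeFrom-filled : ∀ {n occ prev L} a → FilledUpTo n occ prev L → prev ≤ a →
  firstFreeFrom a occ (range1 n) ≡ (if a ⊔ suc L ≤ᵇ n then just (a ⊔ suc L) else nothing)
firstFreeFrom-filled {n} {occ} {prev} {L} a filled prev≤a = begin
  firstFreeFrom a occ (range1 n)             ≡⟨ cong (firstFreeFrom a occ) (range1≡interval n) ⟩
  firstFreeFrom a occ (interval 1 n)         ≡⟨ firstFreeFrom-interval a occ q 1 n free⇔q≤ (≤-trans (s≤s z≤n) (m≤n⊔m a (suc L))) ⟩
  (if q <ᵇ suc n then just q else nothing)   ≡⟨ cong (λ b → if b then just q else nothing) (<ᵇ-suc q n) ⟩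
  (if q ≤ᵇ n then just q else nothing)       ∎
  where
    q = a ⊔ suc L
    free⇔q≤ : ∀ x → 1 ≤ x → x < 1 + n → ((a ≤ᵇ x) ∧ not (occupied x occ)) ≡ (q ≤ᵇ x)
    free⇔q≤ x 1≤x (s≤s x≤n) with a ≤? x
    ... | no a≰x rewrite ≤ᵇ-false (≰⇒> a≰x) = sym (≤ᵇ-false (<-≤-trans (≰⇒> a≰x) (m≤m⊔n a (suc L))))
    ... | yes a≤x rewrite ≤ᵇ-true a≤x | occupied⇔≤ filled x (≤-trans prev≤a a≤x) 1≤x x≤n with x ≤? L
    ...   | yes x≤L rewrite ≤ᵇ-true x≤L = sym (≤ᵇ-false (<-≤-trans (s≤s x≤L) (m≤n⊔m a (suc L))))
    ...   | no x≰L rewrite ≤ᵇ-false (≰⇒> x≰L) = sym (≤ᵇ-true (⊔-lub a≤x (≰⇒> x≰L)))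

filled-park : ∀ {n occ prev L} a → FilledUpTo n occ prev L → prev ≤ a → FilledUpTo n (a ⊔ suc L ∷ occ) a (a ⊔ suc L)
filled-park {n} {occ} {prev} {L} a filled prev≤a = filledUpTo occupied⇔≤′
  where
    q = a ⊔ suc L
    occupied⇔≤′ : ∀ x → a ≤ x → 1 ≤ x → x ≤ n → ((q ≡ᵇ x) ∨ occupied x occ) ≡ (x ≤ᵇ q)
    occupied⇔≤′ x a≤x 1≤x x≤n rewrite occupied⇔≤ filled x (≤-trans prev≤a a≤x) 1≤x x≤n with x ≤? L
    ... | yes x≤L rewrite ≤ᵇ-true x≤L | ≤ᵇ-true (≤-trans (≤-trans x≤L (n≤1+n L)) (m≤n⊔m a (suc L))) = ∨-zeroʳ _
    ... | no x≰L rewrite ≤ᵇ-false (≰⇒> x≰L) | ∨-identityʳ (q ≡ᵇ x) with <-cmp q x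
    ...   | tri< q<x _ _ rewrite ≡ᵇ-false (<⇒≢ q<x) | ≤ᵇ-false q<x = refl
    ...   | tri≈ _ refl _ rewrite ≡ᵇ-true (refl {x = x}) | ≤ᵇ-true (≤-refl {x}) = refl
    ...   | tri> _ _ x<q = ⊥-elim (<⇒≱ x<q (⊔-lub a≤x (≰⇒> x≰L)))

filled-flaw : ∀ {n occ prev L} a → FilledUpTo n occ prev L → prev ≤ a → n < a ⊔ suc L → FilledUpTo n occ a (suc L)
filled-flaw {n} {occ} {prev} {L} a filled prev≤a n<q = filledUpTo occupied⇔≤′
  where
    occupied⇔≤′ : ∀ x → a ≤ x → 1 ≤ x → x ≤ n → occupied x occ ≡ (x ≤ᵇ suc L)
    occupied⇔≤′ x a≤x 1≤x x≤n =
      trans (occupied⇔≤ filled x (≤-trans prev≤a a≤x) 1≤x x≤n) (trans (≤ᵇ-true x≤L) (sym (≤ᵇ-true (m≤n⇒m≤1+n x≤L))))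
      where
        x<q : x < a ⊔ suc L
        x<q = ≤-<-trans x≤n n<q
        x≤L : x ≤ L
        x≤L with ≤-total a (suc L)
        ... | inj₁ a≤1+L = ≤-pred (subst (x <_) (m≤n⇒m⊔n≡n a≤1+L) x<q)
        ... | inj₂ 1+L≤a = ⊥-elim (<⇒≱ (subst (x <_) (m≥n⇒m⊔n≡m 1+L≤a) x<q) a≤x)

ordered-∷ : ∀ b a s → T (orderedᵇ (b ∷ a ∷ s)) → b ≤ a × T (orderedᵇ (a ∷ s))
ordered-∷ b a s ord = map₁ (≤ᵇ⇒≤ b a) (Equivalence.to T-∧ ord)

flawsAux-park : ∀ n occ a s q → firstFreeFrom a occ (range1 n) ≡ just q → flawsAux n occ (a ∷ s) ≡ flawsAux n (q ∷ occ) s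
flawsAux-park n occ a s q parks rewrite parks = refl

flawsAux-flaw : ∀ n occ a s → firstFreeFrom a occ (range1 n) ≡ nothing → flawsAux n occ (a ∷ s) ≡ suc (flawsAux n occ s)
flawsAux-flaw n occ a s fails rewrite fails = refl

flawsAux-ordered : ∀ n occ prev L s → FilledUpTo n occ prev L → T (orderedᵇ (prev ∷ s)) →
  flawsAux n occ s ≡ frontierFlaws n L s
flawsAux-ordered n occ prev L [] _ _ = refl
flawsAux-ordered n occ prev L (a ∷ s) filled ord with ordered-∷ prev a s ord
... | prev≤a , ord′ with a ⊔ suc L ≤ᵇ n in fits | firstFreeFrom-filled a filled prev≤a
...   | true | parks = trans (flawsAux-park n occ a s _ parks)
                            (flawsAux-ordered n _ a _ s (filled-park a filled prev≤a) ord′)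
...   | false | fails = trans (flawsAux-flaw n occ a s fails)
                              (cong suc (flawsAux-ordered n occ a (suc L) s (filled-flaw a filled prev≤a (≤ᵇ-false⇒> fits)) ord′))

length≤free+frontierFlaws : ∀ n L s → length s ≤ (n ∸ L) + frontierFlaws n L s
length≤free+frontierFlaws n L [] = z≤n
length≤free+frontierFlaws n L (a ∷ s) with a ⊔ suc L ≤ᵇ n in fits
... | true = ≤-trans (s≤s (length≤free+frontierFlaws n (a ⊔ suc L) s))
                     (+-monoˡ-≤ _ (∸-monoʳ-< (m≤n⊔m a (suc L)) (≤ᵇ-true⇒≤ fits)))
... | false = subst (suc (length s) ≤_) (sym (+-suc (n ∸ L) _))
                    (s≤s (≤-trans (length≤free+frontierFlaws n (suc L) s) (+-monoˡ-≤ _ (∸-monoʳ-≤ n (n≤1+n L)))))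

-- Since every car parks or is a flaw, equality in length≤free+frontierFlaws means every free
-- space gets filled.
tight : ℕ → ℕ → List ℕ → Bool
tight n L s = (n ∸ L) + frontierFlaws n L s ≡ᵇ length s

frontierFlaws-≤suc : ∀ n L a s → a ≤ suc L →
  (n ∸ L) + frontierFlaws n L (a ∷ s) ≡ suc ((n ∸ suc L) + frontierFlaws n (suc L) s)
frontierFlaws-≤suc n L a s a≤1+L with suc L ≤? n
... | yes 1+L≤n = begin
  (n ∸ L) + frontierFlaws n L (a ∷ s)                ≡⟨ cong₂ _+_ (+-∸-assoc 1 1+L≤n) (frontierFlaws-park n L a s fits) ⟩
  suc (n ∸ suc L) + frontierFlaws n (a ⊔ suc L) s    ≡⟨ cong (λ q → suc (n ∸ suc L) + frontierFlaws n q s) q≡1+L ⟩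
  suc (n ∸ suc L) + frontierFlaws n (suc L) s        ∎
  where
    q≡1+L = m≤n⇒m⊔n≡n a≤1+L
    fits : (a ⊔ suc L ≤ᵇ n) ≡ true
    fits = subst (λ q → (q ≤ᵇ n) ≡ true) (sym q≡1+L) (≤ᵇ-true 1+L≤n)
... | no 1+L≰n = begin
  (n ∸ L) + frontierFlaws n L (a ∷ s)                ≡⟨ cong₂ _+_ (m≤n⇒m∸n≡0 (≤-pred n<1+L)) (frontierFlaws-flaw n L a s full) ⟩
  suc (frontierFlaws n (suc L) s)                    ≡⟨ cong (λ x → suc (x + frontierFlaws n (suc L) s)) (m≤n⇒m∸n≡0 (<⇒≤ n<1+L)) ⟨
  suc ((n ∸ suc L) + frontierFlaws n (suc L) s)      ∎
  where
    n<1+L = ≰⇒> 1+L≰n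
    full : (a ⊔ suc L ≤ᵇ n) ≡ false
    full = subst (λ q → (q ≤ᵇ n) ≡ false) (sym (m≤n⇒m⊔n≡n a≤1+L)) (≤ᵇ-false n<1+L)

module _ (n : ℕ) where

  tightCount : ℕ → ℕ → ℕ → ℕ
  tightCount l v L = count (λ s → orderedᵇ (v ∷ s) ∧ tight n L s) l n

  -- A first car beyond suc L leaves space suc L empty for good.
  tightCount-first : ∀ l v L a → a ≤ n →
    count (λ s → orderedᵇ (v ∷ a ∷ s) ∧ tight n L (a ∷ s)) l n
      ≡ (if v ≤ᵇ a then (if a ≤ᵇ suc L then tightCount l a (suc L) else 0) else 0)
  tightCount-first l v L a a≤n with v ≤ᵇ a | a ≤? suc L
  ... | false | _ = count-none l n (λ _ _ → refl)
  ... | true | yes a≤1+L rewrite ≤ᵇ-true a≤1+L =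
    count-cong l n (λ s _ → cong (λ x → orderedᵇ (a ∷ s) ∧ (x ≡ᵇ suc (length s))) (frontierFlaws-≤suc n L a s a≤1+L))
  ... | true | no a≰1+L rewrite ≤ᵇ-false (≰⇒> a≰1+L) =
    count-none l n (λ s _ → trans (cong (orderedᵇ (a ∷ s) ∧_) (≡ᵇ-false (>⇒≢ (gap s)))) (∧-zeroʳ _))
    where
      a≡q : a ≡ a ⊔ suc L
      a≡q = sym (m≥n⇒m⊔n≡m (<⇒≤ (≰⇒> a≰1+L)))
      a>1+L = ≰⇒> a≰1+L
      parks-at-a : ∀ s → frontierFlaws n L (a ∷ s) ≡ frontierFlaws n a s
      parks-at-a s = trans (frontierFlaws-park n L a s (subst (λ q → (q ≤ᵇ n) ≡ true) a≡q (≤ᵇ-true a≤n)))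
                           (cong (λ q → frontierFlaws n q s) (sym a≡q))
      two-more-free : 2 + (n ∸ a) ≤ n ∸ L
      two-more-free = ≤-trans (s≤s (∸-monoʳ-< a>1+L a≤n)) (∸-monoʳ-< (n<1+n L) (<⇒≤ (<-≤-trans a>1+L a≤n)))
      gap : ∀ s → suc (length s) < (n ∸ L) + frontierFlaws n L (a ∷ s)
      gap s = subst (λ f → suc (length s) < (n ∸ L) + f) (sym (parks-at-a s))
                    (≤-trans (s≤s (s≤s (length≤free+frontierFlaws n a s))) (+-monoˡ-≤ _ two-more-free))

  tightCount-suc : ∀ l v L →
    tightCount (suc l) v L ≡ ∑ n (λ i → if v ≤ᵇ suc i then (if suc i ≤ᵇ suc L then tightCount l (suc i) (suc L) else 0) else 0)
  tightCount-suc l v L = ∑-cong n (λ i i<n → tightCount-first l v L (suc i) i<n)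

  tightCount-step : ∀ l w L → w < n → w ≤ L →
    tightCount (suc l) (suc w) L ≡ tightCount l (suc w) (suc L) + tightCount (suc l) (2 + w) L
  tightCount-step l w L w<n w≤L = begin
    tightCount (suc l) (suc w) L                                  ≡⟨ tightCount-suc l (suc w) L ⟩
    ∑ n (λ i → if suc w ≤ᵇ suc i then next i else 0)
      ≡⟨ ∑-cong n (λ i _ → cong (λ b → if b then next i else 0) (<ᵇ-suc w i)) ⟩
    ∑ n (λ i → if w ≤ᵇ i then next i else 0)                      ≡⟨ ∑-split-≤ᵇ n w next ⟩
    (if w <ᵇ n then next w else 0) + ∑ n (λ i → if suc w ≤ᵇ i then next i else 0)
      ≡⟨ cong₂ _+_ (cong (λ b → if b then next w else 0) (<ᵇ-true w<n)) (sym (tightCount-suc l (2 + w) L)) ⟩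
    next w + tightCount (suc l) (2 + w) L
      ≡⟨ cong (λ b → (if b then tightCount l (suc w) (suc L) else 0) + tightCount (suc l) (2 + w) L) (≤ᵇ-true (s≤s w≤L)) ⟩
    tightCount l (suc w) (suc L) + tightCount (suc l) (2 + w) L   ∎
    where
      next : ℕ → ℕ
      next i = if suc i ≤ᵇ suc L then tightCount l (suc i) (suc L) else 0

  tightCount-vanishes : ∀ l v L → suc L < v ⊎ n < v → tightCount (suc l) v L ≡ 0
  tightCount-vanishes l v L out =
    trans (tightCount-suc l v L) (trans (∑-cong n (λ i i<n → term i (beyond i i<n))) (∑-zero n))
    where
      beyond : ∀ i → i < n → v ≤ suc i → suc L < suc i
      beyond i i<n v≤1+i = [ (λ 1+L<v → <-≤-trans 1+L<v v≤1+i) , (λ n<v → ⊥-elim (<⇒≱ n<v (≤-trans v≤1+i i<n))) ] out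
      term : ∀ i → (v ≤ suc i → suc L < suc i) →
        (if v ≤ᵇ suc i then (if suc i ≤ᵇ suc L then tightCount l (suc i) (suc L) else 0) else 0) ≡ 0
      term i beyond-L with v ≤? suc i
      ... | no v≰1+i rewrite ≤ᵇ-false (≰⇒> v≰1+i) = refl
      ... | yes v≤1+i rewrite ≤ᵇ-true v≤1+i | ≤ᵇ-false (beyond-L v≤1+i) = refl

  -- Tight continuations are walks: an up-step is a car, a down-step raises the least admissible
  -- preference suc w by one, and the height h = L - w counts the occupied spaces from suc w on.
  tightCount≡walks : ∀ l t h w L → suc w + t ≡ n → suc w + h ≡ suc L → tightCount l (suc w) L ≡ walks 1 h l t
  tightCount≡walks zero t h w L w+t≡n w+h≡L = cong (λ b → if b then 1 else 0) no-free⇔t<h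
    where
      no-free⇔t<h : ((n ∸ L) + 0 ≡ᵇ 0) ≡ (suc t ≤ᵇ h)
      no-free⇔t<h with t <? h
      ... | yes t<h rewrite m≤n⇒m∸n≡0 (≤-pred (subst₂ _<_ w+t≡n w+h≡L (+-monoʳ-< (suc w) t<h))) = sym (≤ᵇ-true t<h)
      ... | no t≮h rewrite +-identityʳ (n ∸ L) =
        trans (≡ᵇ-false (m>n⇒m∸n≢0 (subst₂ _≤_ w+h≡L w+t≡n (+-monoʳ-≤ (suc w) (≮⇒≥ t≮h)))))
              (sym (≤ᵇ-false (s≤s (≮⇒≥ t≮h))))
  tightCount≡walks (suc l) t h w L w+t≡n w+h≡L = begin
    tightCount (suc l) (suc w) L                                ≡⟨ tightCount-step l w L w<n w≤L ⟩
    tightCount l (suc w) (suc L) + tightCount (suc l) (2 + w) L ≡⟨ cong (_+ tightCount (suc l) (2 + w) L) car-at-w ⟩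
    walks 1 (suc h) l t + tightCount (suc l) (2 + w) L          ≡⟨ no-car-at-w h t w+t≡n w+h≡L ⟩
    walks 1 h (suc l) t                                         ∎
    where
      w<n = m+n≤o⇒m≤o (suc w) (≤-reflexive w+t≡n)
      w≤L = ≤-pred (m+n≤o⇒m≤o (suc w) (≤-reflexive w+h≡L))
      car-at-w : tightCount l (suc w) (suc L) ≡ walks 1 (suc h) l t
      car-at-w = tightCount≡walks l t (suc h) w (suc L) w+t≡n (trans (+-suc (suc w) h) (cong suc w+h≡L))
      no-car-at-w : ∀ h t → suc w + t ≡ n → suc w + h ≡ suc L →
        walks 1 (suc h) l t + tightCount (suc l) (2 + w) L ≡ walks 1 h (suc l) t
      no-car-at-w zero t _ w+0≡L = trans (cong (walks 1 1 l t +_) (tightCount-vanishes l (2 + w) L (inj₁ 1+L<2+w))) (+-identityʳ _)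
        where 1+L<2+w = s≤s (≤-reflexive (sym (trans (sym (+-identityʳ (suc w))) w+0≡L)))
      no-car-at-w (suc h) zero w+0≡n _ = trans (cong (walks 1 (2 + h) l 0 +_) (tightCount-vanishes l (2 + w) L (inj₂ n<2+w))) (+-identityʳ _)
        where n<2+w = s≤s (≤-reflexive (sym (trans (sym (+-identityʳ (suc w))) w+0≡n)))
      no-car-at-w (suc h) (suc t) w+t≡n w+h≡L = cong (walks 1 (2 + h) l (suc t) +_)
        (tightCount≡walks (suc l) t h (suc w) L (trans (sym (+-suc (suc w) t)) w+t≡n) (trans (sym (+-suc (suc w) h)) w+h≡L))

flaws-leading : ∀ n k s → k < n → T (orderedᵇ (suc k ∷ s)) → flaws n (suc k ∷ s) ≡ frontierFlaws n (suc k) s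
flaws-leading n k s k<n ord = begin
  flaws n (suc k ∷ s)                   ≡⟨ flawsAux-ordered n [] 0 0 (suc k ∷ s) empty ord ⟩
  frontierFlaws n 0 (suc k ∷ s)         ≡⟨ frontierFlaws-park n 0 (suc k) s fits ⟩
  frontierFlaws n (suc k ⊔ 1) s         ≡⟨ cong (λ q → frontierFlaws n q s) 1+k⊔1≡1+k ⟩
  frontierFlaws n (suc k) s             ∎
  where
    empty : FilledUpTo n [] 0 0
    empty = filledUpTo (λ x _ 1≤x _ → sym (≤ᵇ-false 1≤x))
    1+k⊔1≡1+k : suc k ⊔ 1 ≡ suc k
    1+k⊔1≡1+k = cong suc (⊔-identityʳ k)
    fits : (suc k ⊔ 1 ≤ᵇ n) ≡ true
    fits = subst (λ q → (q ≤ᵇ n) ≡ true) (sym 1+k⊔1≡1+k) (≤ᵇ-true k<n)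

op-leading : ∀ k m → op (suc (k + m)) k (suc k) ≡ ballot (suc k) m
op-leading k m = begin
  op n k (suc k)                                             ≡⟨ length-filter-seqs P n n ⟩
  ∑ n (λ i → count (λ s → P (suc i ∷ s)) l n)                ≡⟨ ∑-cong n (λ i _ → first-car i) ⟩
  ∑ n (λ i → if i ≡ᵇ k then tightCount n l (suc k) (suc k) else 0) ≡⟨ ∑-indicator n k _ ⟩
  (if k <ᵇ n then tightCount n l (suc k) (suc k) else 0)     ≡⟨ cong (λ b → if b then tightCount n l (suc k) (suc k) else 0) (<ᵇ-true k<n) ⟩
  tightCount n l (suc k) (suc k)                             ≡⟨ tightCount≡walks n l m 1 k (suc k) refl (+-comm (suc k) 1) ⟩
  walks 1 1 l m                                              ≡⟨ walks-positive-end 1 l m (s≤s (m≤n+m m k)) ⟩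
  walks 0 1 l m                                              ∎
  where
    l = k + m
    n = suc l
    k<n : k < n
    k<n = s≤s (m≤m+n k m)
    P : List ℕ → Bool
    P p = orderedᵇ p ∧ ((flaws n p ≡ᵇ k) ∧ leadingIsᵇ (suc k) p)
    flaws⇔tight : ∀ s → length s ≡ l →
      (orderedᵇ (suc k ∷ s) ∧ ((flaws n (suc k ∷ s) ≡ᵇ k) ∧ true)) ≡ (orderedᵇ (suc k ∷ s) ∧ tight n (suc k) s)
    flaws⇔tight s len with orderedᵇ (suc k ∷ s) in ord
    ... | false = refl
    ... | true rewrite flaws-leading n k s k<n (Equivalence.from T-≡ ord) | len | m+n∸m≡n k m =
      trans (∧-identityʳ _) (sym (trans (cong (m + frontierFlaws n (suc k) s ≡ᵇ_) (+-comm k m)) (≡ᵇ-+ˡ m _ k)))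
    first-car : ∀ i → count (λ s → P (suc i ∷ s)) l n ≡ (if i ≡ᵇ k then tightCount n l (suc k) (suc k) else 0)
    first-car i with i ≡ᵇ k in i≟k
    ... | false = count-none l n (λ s _ → trans (cong (orderedᵇ (suc i ∷ s) ∧_) (∧-zeroʳ _)) (∧-zeroʳ _))
    ... | true with refl ← ≡ᵇ-true⇒≡ {i} {k} i≟k = count-cong l n flaws⇔tight

-- Power series

yPowTimes : ℕ → Series → Series
yPowTimes zero g = g
yPowTimes (suc d) g = yTimes (yPowTimes d g)

yPowTimes-+ : ∀ d g m → yPowTimes d g (d + m) ≡ g m
yPowTimes-+ zero g m = refl
yPowTimes-+ (suc d) g m = yPowTimes-+ d g m

yPowTimes-< : ∀ d g x → x < d → yPowTimes d g x ≡ 0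
yPowTimes-< (suc d) g zero _ = refl
yPowTimes-< (suc d) g (suc x) (s≤s x<d) = yPowTimes-< d g x x<d

yTimes-cong : ∀ {f g : Series} → f ≗ g → yTimes f ≗ yTimes g
yTimes-cong f≗g zero = refl
yTimes-cong f≗g (suc x) = f≗g x

yPowTimes-cong : ∀ d {f g : Series} → f ≗ g → yPowTimes d f ≗ yPowTimes d g
yPowTimes-cong zero f≗g = f≗g
yPowTimes-cong (suc d) f≗g = yTimes-cong (yPowTimes-cong d f≗g)

⊛-∑ : ∀ f g n → (f ⊛ g) n ≡ ∑ (suc n) (λ i → f i * g (n ∸ i))
⊛-∑ f g n = ∑-upTo (suc n) (λ i → f i * g (n ∸ i))

⊛-congʳ : ∀ f {g g′ : Series} → g ≗ g′ → (f ⊛ g) ≗ (f ⊛ g′)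
⊛-congʳ f {g} {g′} g≗g′ n = begin
  (f ⊛ g) n                              ≡⟨ ⊛-∑ f g n ⟩
  ∑ (suc n) (λ i → f i * g (n ∸ i))      ≡⟨ ∑-cong (suc n) (λ i _ → cong (f i *_) (g≗g′ (n ∸ i))) ⟩
  ∑ (suc n) (λ i → f i * g′ (n ∸ i))     ≡⟨ ⊛-∑ f g′ n ⟨
  (f ⊛ g′) n                             ∎

⊛-yTimes : ∀ f g → (f ⊛ yTimes g) ≗ yTimes (f ⊛ g)
⊛-yTimes f g zero = trans (⊛-∑ f (yTimes g) 0) (*-zeroʳ (f 0))
⊛-yTimes f g (suc n) = begin
  (f ⊛ yTimes g) (suc n)                                                       ≡⟨ ⊛-∑ f (yTimes g) (suc n) ⟩
  ∑ (suc n) (λ i → f i * yTimes g (suc n ∸ i)) + f (suc n) * yTimes g (n ∸ n)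
    ≡⟨ cong₂ _+_ (∑-suc-∸ n (λ i t → f i * yTimes g t))
                 (trans (cong (λ t → f (suc n) * yTimes g t) (n∸n≡0 n)) (*-zeroʳ (f (suc n)))) ⟩
  ∑ (suc n) (λ i → f i * g (n ∸ i)) + 0                                        ≡⟨ +-identityʳ _ ⟩
  ∑ (suc n) (λ i → f i * g (n ∸ i))                                            ≡⟨ ⊛-∑ f g n ⟨
  (f ⊛ g) n                                                                    ∎

⊛-yPowTimes : ∀ d f g → (f ⊛ yPowTimes d g) ≗ yPowTimes d (f ⊛ g)
⊛-yPowTimes zero f g n = refl
⊛-yPowTimes (suc d) f g n = trans (⊛-yTimes f (yPowTimes d g) n) (yTimes-cong (⊛-yPowTimes d f g) n)

Cat⊛ballot : ∀ j → (Cat ⊛ ballot j) ≗ ballot (suc j)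
Cat⊛ballot j m = begin
  (Cat ⊛ ballot j) m                                    ≡⟨ ⊛-∑ Cat (ballot j) m ⟩
  ∑ (suc m) (λ i → Cat i * ballot j (m ∸ i))            ≡⟨ ∑-cong (suc m) (λ i _ → cong (_* ballot j (m ∸ i)) (Cat≡ballot-0 i)) ⟩
  ∑ (suc m) (λ i → ballot 0 i * ballot j (m ∸ i))       ≡⟨ ballot-convolution m j ⟨
  ballot (suc j) m                                      ∎

φ≡yPowTimes : ∀ k → φ k ≗ yPowTimes (suc k) (ballot (suc k))
φ≡yPowTimes k x with suc k ≤? x
... | no 1+k≰x rewrite ≤ᵇ-false (≰⇒> 1+k≰x) = sym (yPowTimes-< (suc k) (ballot (suc k)) x (≰⇒> 1+k≰x))
... | yes 1+k≤x with m , refl ← m≤n⇒∃[o]m+o≡n 1+k≤x rewrite ≤ᵇ-true 1+k≤x =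
  trans (op-leading k m) (sym (yPowTimes-+ (suc k) (ballot (suc k)) m))

mainTheorem15 : ((n : ℕ) → φ 0 n ≡ yTimes (Cat ⊛ Cat) n)
                × ((k n : ℕ) → φ (suc k) n ≡ yTimes (Cat ⊛ φ k) n)
mainTheorem15 = φ₀ , φ-suc
  where
    φ₀ : (n : ℕ) → φ 0 n ≡ yTimes (Cat ⊛ Cat) n
    φ₀ n = trans (φ≡yPowTimes 0 n) (yTimes-cong (λ m → begin
      ballot 1 m             ≡⟨ Cat⊛ballot 0 m ⟨
      (Cat ⊛ ballot 0) m     ≡⟨ ⊛-congʳ Cat (λ i → sym (Cat≡ballot-0 i)) m ⟩
      (Cat ⊛ Cat) m          ∎) n)
    φ-suc : (k n : ℕ) → φ (suc k) n ≡ yTimes (Cat ⊛ φ k) n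
    φ-suc k n = trans (φ≡yPowTimes (suc k) n) (yTimes-cong (λ m → begin
      yPowTimes (suc k) (ballot (2 + k)) m               ≡⟨ yPowTimes-cong (suc k) (Cat⊛ballot (suc k)) m ⟨
      yPowTimes (suc k) (Cat ⊛ ballot (suc k)) m         ≡⟨ ⊛-yPowTimes (suc k) Cat (ballot (suc k)) m ⟨
      (Cat ⊛ yPowTimes (suc k) (ballot (suc k))) m       ≡⟨ ⊛-congʳ Cat (λ i → sym (φ≡yPowTimes k i)) m ⟩
      (Cat ⊛ φ k) m                                      ∎) n)
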